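{- Let $m$ be an odd positive integer, and let $\ell=\lceil\log_2 m\rceil$. If $\mathfrak K(m)>2^\ell+1$, then ${\bf t}_{m+1}{\bf t}_{m+2}=11$ and ${\bf t}_{2m+1}{\bf t}_{2m+2}=10$.
   Context: The Thue-Morse word is the infinite binary word ${\bf t}={\bf t}_1{\bf t}_2{\bf t}_3\cdots$, where ${\bf t}_i\in\{0,1\}$ has the same parity as the number of $1$'s in the binary expansion of $i-1$. A $k$-anti-power is a word of the form $w_1w_2\cdots w_k$ where $w_1,\ldots,w_k$ are pairwise distinct words all of the same length. For a positive integer $m$, $\mathfrak K(m)$ denotes the smallest positive integer $k$ such that the prefix of ${\bf t}$ of length $km$ is not a $k$-anti-power. -}

module Defs where

open import Data.Nat using (ℕ; zero; suc; _+_; _*_; _<_; _≤_; _%_; _/_)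
open import Data.Bool using (Bool; true; false; _xor_)
open import Data.List using (List; map; upTo)
open import Data.Product using (_×_)
open import Relation.Binary.PropositionalEquality using (_≡_)
open import Relation.Nullary using (¬_)

-- Parity of the number of 1's in the binary expansion of n (true = odd),
-- computed with fuel (fuel ≥ n suffices since n/2 < n).
parityFuel : ℕ → ℕ → Bool
parityFuel zero    n = false
parityFuel (suc f) zero = false
parityFuel (suc f) (suc n) =
  ((suc n % 2) Data.Nat.≡ᵇ 1) xor parityFuel f (suc n / 2)

bitParity : ℕ → Bool
bitParity n = parityFuel n n

-- Thue–Morse word, 1-indexed: t i for i ≥ 1 has the parity of popcount(i-1).
-- (true = 1, false = 0). The value at i = 0 is irrelevant junk.
t : ℕ → Bool
t zero    = false
t (suc i) = bitParity i

factor : ℕ → ℕ → List Bool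
factor s m = map (λ i → t (s + suc i)) (upTo m)

block : ℕ → ℕ → List Bool
block m j = factor (j * m) m

IsAntiPowerPrefix : ℕ → ℕ → Set
IsAntiPowerPrefix k m = ∀ i j → i < k → j < k → block m i ≡ block m j → i ≡ j

IsK : ℕ → ℕ → Set
IsK m k = (1 ≤ k) × ¬ IsAntiPowerPrefix k m
        × (∀ j → 1 ≤ j → j < k → IsAntiPowerPrefix j m)

-- Write s n for the parity of the binary digit sum of n, so that t (1 + n) = s n.
-- For i < 2^ℓ the binary expansion of a * 2^ℓ + i is that of a followed by
-- that of i, so s (a * 2^ℓ + i) = s a xor s i.  If m ≤ 2^ℓ, block 2^ℓ of
-- length m is therefore block 0 complemented or not according to s m; as the
-- prefix of 2^ℓ + 1 blocks is an anti-power, s m = 1.  Writing m = 2q + 1 and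
-- h = 2^(ℓ-1), the same rule shows that if s q = s (q + 1) = 0 then block h
-- coincides with block 2^ℓ; since s m = ¬ s q, this forces s (m + 1) = s (q + 1) = 1.
-- The values at 2m + 1 and 2m + 2 follow from s (2n) = s n, s (2n + 1) = ¬ s n.
module Submission where

open import Defs
open import Data.Nat using (ℕ; zero; suc; _+_; _*_; _^_; _∸_; _<_; _≤_; _%_; _/_; _≡ᵇ_; ⌊_/2⌋; ⌈_/2⌉; s≤s; z≤n; z<s)
open import Data.Nat.Properties
open import Data.Nat.DivMod using (m*n/n≡m; m*n%n≡0; [m+kn]%n≡m%n; +-distrib-/-∣ʳ; m<n*o⇒m/o<n; m/n<m)
open import Data.Nat.Divisibility using (_∣_; divides; n∣m*n; ∣-refl; ∣m∣n⇒∣m+n)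
open import Data.Nat.Logarithm using (⌈log₂_⌉; ⌈log₂⌉-mono-≤; ⌈log₂⌈n/2⌉⌉≡⌈log₂n⌉∸1)
open import Data.Nat.Tactic.RingSolver using (solve-∀)
open import Data.Bool using (true; false; not; _xor_)
open import Data.Bool.Properties using (xor-assoc; xor-comm; xor-identityʳ; ¬-not; not-involutive; not-injective)
open import Data.List.Properties using (map-cong-local)
open import Data.List.Relation.Unary.All.Properties using (applyUpTo⁺₁)
open import Data.Product using (_×_; _,_; ∃)
open import Data.Empty using (⊥-elim)
open import Relation.Binary.PropositionalEquality using (_≡_; _≢_; refl; sym; trans; cong; cong₂; subst; module ≡-Reasoning)
open import Relation.Nullary using (¬_; yes; no)

open ≡-Reasoning

suc-/2≤ : ∀ n → suc n / 2 ≤ n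
suc-/2≤ n = ≤-pred (m/n<m (suc n) 2 (s≤s (s≤s z≤n)))

parityFuel-zero : ∀ f → parityFuel f 0 ≡ false
parityFuel-zero zero = refl
parityFuel-zero (suc f) = refl

parityFuel-irrelevant : ∀ f g n → n ≤ f → n ≤ g → parityFuel f n ≡ parityFuel g n
parityFuel-irrelevant f g zero _ _ = trans (parityFuel-zero f) (sym (parityFuel-zero g))
parityFuel-irrelevant (suc f) (suc g) (suc n) (s≤s n≤f) (s≤s n≤g) =
  cong ((suc n % 2 ≡ᵇ 1) xor_)
    (parityFuel-irrelevant f g (suc n / 2) (≤-trans (suc-/2≤ n) n≤f) (≤-trans (suc-/2≤ n) n≤g))

bitParity-unfold : ∀ n → bitParity n ≡ (n % 2 ≡ᵇ 1) xor bitParity (n / 2)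
bitParity-unfold zero = refl
bitParity-unfold (suc n) =
  cong ((suc n % 2 ≡ᵇ 1) xor_) (parityFuel-irrelevant n (suc n / 2) (suc n / 2) (suc-/2≤ n) ≤-refl)

bitParity-digits : ∀ n {r d} → n % 2 ≡ r → n / 2 ≡ d → bitParity n ≡ (r ≡ᵇ 1) xor bitParity d
bitParity-digits n refl refl = bitParity-unfold n

bitParity-double : ∀ n → bitParity (n * 2) ≡ bitParity n
bitParity-double n = bitParity-digits (n * 2) (m*n%n≡0 n 2) (m*n/n≡m n 2)

bitParity-double+1 : ∀ n → bitParity (1 + n * 2) ≡ not (bitParity n)
bitParity-double+1 n =
  bitParity-digits (1 + n * 2) ([m+kn]%n≡m%n 1 n 2)
    (trans (+-distrib-/-∣ʳ 1 (n∣m*n n {2})) (m*n/n≡m n 2))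

bitParity-*2^+ : ∀ k a x → x < 2 ^ k → bitParity (a * 2 ^ k + x) ≡ bitParity a xor bitParity x
bitParity-*2^+ zero a zero _ = begin
  bitParity (a * 1 + 0)   ≡⟨ cong bitParity (trans (+-identityʳ (a * 1)) (*-identityʳ a)) ⟩
  bitParity a             ≡⟨ sym (xor-identityʳ (bitParity a)) ⟩
  bitParity a xor false   ∎
bitParity-*2^+ zero a (suc x) (s≤s ())
bitParity-*2^+ (suc k) a x x<2^1+k = begin
  bitParity (a * 2 ^ suc k + x)
    ≡⟨ cong bitParity (shift (2 ^ k)) ⟩
  bitParity (x + a * 2 ^ k * 2)
    ≡⟨ bitParity-digits (x + a * 2 ^ k * 2) ([m+kn]%n≡m%n x (a * 2 ^ k) 2) quotient ⟩
  (x % 2 ≡ᵇ 1) xor bitParity (a * 2 ^ k + x / 2)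
    ≡⟨ cong ((x % 2 ≡ᵇ 1) xor_) (bitParity-*2^+ k a (x / 2) x/2<2^k) ⟩
  (x % 2 ≡ᵇ 1) xor (bitParity a xor bitParity (x / 2))
    ≡⟨ xor-swap (x % 2 ≡ᵇ 1) (bitParity a) (bitParity (x / 2)) ⟩
  bitParity a xor ((x % 2 ≡ᵇ 1) xor bitParity (x / 2))
    ≡⟨ cong (bitParity a xor_) (bitParity-unfold x) ⟨
  bitParity a xor bitParity x
    ∎
  where
  shift : ∀ p → a * (2 * p) + x ≡ x + a * p * 2
  shift p = trans (+-comm (a * (2 * p)) x) (cong (x +_) (*-rearrange a p))
    where
    *-rearrange : ∀ a p → a * (2 * p) ≡ a * p * 2
    *-rearrange = solve-∀
  quotient : (x + a * 2 ^ k * 2) / 2 ≡ a * 2 ^ k + x / 2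
  quotient = trans (+-distrib-/-∣ʳ x (n∣m*n (a * 2 ^ k) {2}))
                   (trans (cong (x / 2 +_) (m*n/n≡m (a * 2 ^ k) 2)) (+-comm (x / 2) (a * 2 ^ k)))
  x/2<2^k : x / 2 < 2 ^ k
  x/2<2^k = m<n*o⇒m/o<n (subst (x <_) (*-comm 2 (2 ^ k)) x<2^1+k)
  xor-swap : ∀ u v w → u xor (v xor w) ≡ v xor (u xor w)
  xor-swap u v w = trans (sym (xor-assoc u v w)) (trans (cong (_xor w) (xor-comm u v)) (xor-assoc v u w))

bitParity-2^+ : ∀ k x → x < 2 ^ k → bitParity (2 ^ k + x) ≡ not (bitParity x)
bitParity-2^+ k x x<2^k =
  trans (cong (λ z → bitParity (z + x)) (sym (*-identityˡ (2 ^ k)))) (bitParity-*2^+ k 1 x x<2^k)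

⌈log₂1+2^n⌉≡1+n : ∀ n → ⌈log₂ (1 + 2 ^ n) ⌉ ≡ 1 + n
⌈log₂1+2^n⌉≡1+n zero = refl
⌈log₂1+2^n⌉≡1+n (suc n) = ∸1≡suc⇒≡2+ _ (begin
  ⌈log₂ (1 + 2 ^ suc n) ⌉ ∸ 1   ≡⟨ ⌈log₂⌈n/2⌉⌉≡⌈log₂n⌉∸1 (1 + 2 ^ suc n) ⟨
  ⌈log₂ ⌈ 1 + 2 ^ suc n /2⌉ ⌉   ≡⟨ cong (λ z → ⌈log₂ (1 + z) ⌉) (n≡⌊2*n/2⌋ (2 ^ n)) ⟨
  ⌈log₂ (1 + 2 ^ n) ⌉           ≡⟨ ⌈log₂1+2^n⌉≡1+n n ⟩
  1 + n                         ∎)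
  where
  n≡⌊2*n/2⌋ : ∀ x → x ≡ ⌊ 2 * x /2⌋
  n≡⌊2*n/2⌋ x = trans (n≡⌊n+n/2⌋ x) (cong ⌊_/2⌋ (cong (x +_) (sym (+-identityʳ x))))
  ∸1≡suc⇒≡2+ : ∀ x {y} → x ∸ 1 ≡ suc y → x ≡ 2 + y
  ∸1≡suc⇒≡2+ (suc x) refl = refl

n≤2^⌈log₂n⌉ : ∀ n → n ≤ 2 ^ ⌈log₂ n ⌉
n≤2^⌈log₂n⌉ n = ≮⇒≥ λ 2^ℓ<n →
  1+n≰n (subst (_≤ ⌈log₂ n ⌉) (⌈log₂1+2^n⌉≡1+n ⌈log₂ n ⌉) (⌈log₂⌉-mono-≤ 2^ℓ<n))

block-cong : ∀ m a b → (∀ i → i < m → bitParity (a * m + i) ≡ bitParity (b * m + i))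
           → block m a ≡ block m b
block-cong m a b same = map-cong-local (applyUpTo⁺₁ _ m λ {i} i<m →
  trans (cong t (+-suc (a * m) i)) (trans (same i i<m) (cong t (sym (+-suc (b * m) i)))))

bitParity-2^*+ : ∀ ℓ m i → m ≤ 2 ^ ℓ → i < m → bitParity (2 ^ ℓ * m + i) ≡ bitParity m xor bitParity i
bitParity-2^*+ ℓ m i m≤2^ℓ i<m =
  trans (cong (λ z → bitParity (z + i)) (*-comm (2 ^ ℓ) m))
        (bitParity-*2^+ ℓ m i (<-≤-trans i<m m≤2^ℓ))

block-2^≡block-0 : ∀ ℓ m → m ≤ 2 ^ ℓ → bitParity m ≡ false → block m (2 ^ ℓ) ≡ block m 0
block-2^≡block-0 ℓ m m≤2^ℓ m-even = block-cong m (2 ^ ℓ) 0 λ i i<m →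
  trans (bitParity-2^*+ ℓ m i m≤2^ℓ i<m) (cong (_xor bitParity i) m-even)

-- For m = 2q + 1 and h = 2^p, both blocks h and 2h are the complement of block 0:
-- h m + i is q·2h + (h + i) when i < h, and (q + 1)·2h + (i − h) otherwise.
block-2^≡block-2^1+ : ∀ p q → 1 + q * 2 ≤ 2 ^ suc p
                    → bitParity q ≡ false → bitParity (suc q) ≡ false
                    → block (1 + q * 2) (2 ^ p) ≡ block (1 + q * 2) (2 ^ suc p)
block-2^≡block-2^1+ p q m≤2h q-even q+1-even =
  block-cong m h (2 ^ suc p) λ i i<m → trans (left i i<m) (sym (right i i<m))
  where
  m h : ℕ
  m = 1 + q * 2
  h = 2 ^ p
  2^1+p≡h+h : 2 ^ suc p ≡ h + h
  2^1+p≡h+h = cong (h +_) (+-identityʳ h)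
  right : ∀ i → i < m → bitParity (2 ^ suc p * m + i) ≡ not (bitParity i)
  right i i<m = trans (bitParity-2^*+ (suc p) m i m≤2h i<m)
                      (cong (_xor bitParity i) (trans (bitParity-double+1 q) (cong not q-even)))
  low : ∀ h q i → h * (1 + q * 2) + i ≡ q * (2 * h) + (h + i)
  low = solve-∀
  high : ∀ h q y → h * (1 + q * 2) + (h + y) ≡ suc q * (2 * h) + y
  high = solve-∀
  left : ∀ i → i < m → bitParity (h * m + i) ≡ not (bitParity i)
  left i i<m with i <? h
  ... | yes i<h = begin
    bitParity (h * m + i)               ≡⟨ cong bitParity (low h q i) ⟩
    bitParity (q * 2 ^ suc p + (h + i)) ≡⟨ bitParity-*2^+ (suc p) q (h + i) h+i<2h ⟩
    bitParity q xor bitParity (h + i)   ≡⟨ cong₂ _xor_ q-even (bitParity-2^+ p i i<h) ⟩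
    not (bitParity i)                   ∎
    where
    h+i<2h : h + i < 2 ^ suc p
    h+i<2h = subst (h + i <_) (sym 2^1+p≡h+h) (+-monoʳ-< h i<h)
  ... | no i≮h with m≤n⇒∃[o]m+o≡n (≮⇒≥ i≮h)
  ...   | y , refl = begin
    bitParity (h * m + (h + y))         ≡⟨ cong bitParity (high h q y) ⟩
    bitParity (suc q * 2 ^ suc p + y)   ≡⟨ bitParity-*2^+ (suc p) (suc q) y (<-≤-trans y<h (m≤m+n h _)) ⟩
    bitParity (suc q) xor bitParity y   ≡⟨ cong (_xor bitParity y) q+1-even ⟩
    bitParity y                         ≡⟨ not-involutive (bitParity y) ⟨
    not (not (bitParity y))             ≡⟨ cong not (bitParity-2^+ p y y<h) ⟨
    not (bitParity (h + y))             ∎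
    where
    y<h : y < h
    y<h = +-cancelˡ-< h y h (subst (h + y <_) 2^1+p≡h+h (<-≤-trans i<m m≤2h))

antiPower-distinct : ∀ {k m i j} → IsAntiPowerPrefix k m → i < j → j < k → block m i ≢ block m j
antiPower-distinct ap i<j j<k eq = <-irrefl (ap _ _ (<-trans i<j j<k) j<k eq) i<j

antiPower⇒bitParity≡true : ∀ ℓ m → m ≤ 2 ^ ℓ → IsAntiPowerPrefix (2 ^ ℓ + 1) m
                         → bitParity m ≡ true
antiPower⇒bitParity≡true ℓ m m≤2^ℓ ap = ¬-not λ m-even →
  antiPower-distinct ap (m^n>0 2 ℓ) (m<m+n (2 ^ ℓ) z<s) (sym (block-2^≡block-0 ℓ m m≤2^ℓ m-even))

antiPower⇒bitParity-suc≡true : ∀ ℓ q → 1 + q * 2 ≤ 2 ^ ℓ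
                             → IsAntiPowerPrefix (2 ^ ℓ + 1) (1 + q * 2)
                             → bitParity (2 + q * 2) ≡ true
antiPower⇒bitParity-suc≡true zero zero _ _ = refl
antiPower⇒bitParity-suc≡true zero (suc q) (s≤s ()) _
antiPower⇒bitParity-suc≡true (suc p) q m≤2^ℓ ap = ¬-not λ m+1-even →
  antiPower-distinct ap (^-monoʳ-< 2 (s≤s (s≤s z≤n)) (n<1+n p)) (m<m+n (2 ^ suc p) z<s)
    (block-2^≡block-2^1+ p q m≤2^ℓ q-even (trans (sym (bitParity-double (suc q))) m+1-even))
  where
  q-even : bitParity q ≡ false
  q-even = not-injective (trans (sym (bitParity-double+1 q))
                                (antiPower⇒bitParity≡true (suc p) _ m≤2^ℓ ap))

¬2∣⇒≡1+*2 : ∀ n → ¬ 2 ∣ n → ∃ λ q → n ≡ 1 + q * 2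
¬2∣⇒≡1+*2 zero ¬2∣n = ⊥-elim (¬2∣n (divides 0 refl))
¬2∣⇒≡1+*2 (suc zero) _ = 0 , refl
¬2∣⇒≡1+*2 (suc (suc n)) ¬2∣2+n with ¬2∣⇒≡1+*2 n (λ 2∣n → ¬2∣2+n (∣m∣n⇒∣m+n ∣-refl 2∣n))
... | q , n≡1+2q = suc q , cong (2 +_) n≡1+2q

t-+1 : ∀ n → t (n + 1) ≡ bitParity n
t-+1 n = cong t (+-comm n 1)

t-+2 : ∀ n → t (n + 2) ≡ bitParity (1 + n)
t-+2 n = cong t (+-comm n 2)

t-2*+1 : ∀ n → t (2 * n + 1) ≡ bitParity n
t-2*+1 n = trans (t-+1 (2 * n)) (trans (cong bitParity (*-comm 2 n)) (bitParity-double n))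

t-2*+2 : ∀ n → t (2 * n + 2) ≡ not (bitParity n)
t-2*+2 n = trans (t-+2 (2 * n)) (trans (cong (λ z → bitParity (1 + z)) (*-comm 2 n)) (bitParity-double+1 n))

lemma3 : (m k : ℕ) → 1 ≤ m → ¬ (2 ∣ m) → IsK m k
    → 2 ^ ⌈log₂ m ⌉ + 1 < k
    → (t (m + 1) ≡ true × t (m + 2) ≡ true)
    × (t (2 * m + 1) ≡ true × t (2 * m + 2) ≡ false)
lemma3 m k _ ¬2∣m (_ , _ , below-k-antiPower) 2^ℓ+1<k with ¬2∣⇒≡1+*2 m ¬2∣m
... | q , refl =
  (trans (t-+1 m) m-odd , trans (t-+2 m) m+1-odd) ,
  (trans (t-2*+1 m) m-odd , trans (t-2*+2 m) (cong not m-odd))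
  where
  ℓ : ℕ
  ℓ = ⌈log₂ m ⌉
  ap : IsAntiPowerPrefix (2 ^ ℓ + 1) m
  ap = below-k-antiPower (2 ^ ℓ + 1) (m≤n+m 1 (2 ^ ℓ)) 2^ℓ+1<k
  m-odd : bitParity m ≡ true
  m-odd = antiPower⇒bitParity≡true ℓ m (n≤2^⌈log₂n⌉ m) ap
  m+1-odd : bitParity (1 + m) ≡ true
  m+1-odd = antiPower⇒bitParity-suc≡true ℓ q (n≤2^⌈log₂n⌉ m) ap
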